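{- Let $\Sigma=(G,\sigma)$ be a $2$-connected signed graph (with $G$ simple and finite) and $n$ a positive integer. If $\Sigma$ is balanced, then $\Sigma^n=(G^n,\sigma')$ is compatible.
   Context: A signed graph $\Sigma=(G,\sigma)$ consists of a graph $G=(V,E)$ and a signature $\sigma:E\to\{1,-1\}$. The sign of a path or cycle is the product of the signs of its edges; $\Sigma$ is balanced if every cycle has positive sign. For vertices $u,v$, $d(u,v)$ is the distance, and $\mathcal{P}_{(u,v)}$ is the set of shortest $u$–$v$ paths; $\sigma_{\max}(u,v)=\max\{\sigma(P):P\in\mathcal{P}_{(u,v)}\}$, $\sigma_{\min}(u,v)=\min\{\sigma(P):P\in\mathcal{P}_{(u,v)}\}$, $d_{\max}(u,v)=\sigma_{\max}(u,v)d(u,v)$, $d_{\min}(u,v)=\sigma_{\min}(u,v)d(u,v)$. Vertices $u,v$ are compatible if $d_{\max}(u,v)=d_{\min}(u,v)$; a signed graph is compatible if every pair of its vertices is compatible. The $n^{th}$ power $G^n$ has vertex set $V$, with $u\ne v$ adjacent iff $d(u,v)\le n$. $\Sigma_{\max}^n=(G^n,\sigma')$ with $\sigma'(uv)=\sigma_{\max}(u,v)$ and $\Sigma_{\min}^n=(G^n,\sigma'')$ with $\sigma''(uv)=\sigma_{\min}(u,v)$; when these coincide (as they do for balanced $\Sigma$) the common signed graph is denoted $\Sigma^n=(G^n,\sigma')$, and its compatibility is measured with distances and path signs in $\Sigma^n$. -}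

module Defs where

open import Data.Nat using (ℕ; zero; suc; _≤_)
open import Data.Fin using (Fin)
open import Data.Bool using (Bool; true; false; T)
open import Data.Sign using (Sign) renaming (_*_ to _*ˢ_)
open import Data.Integer using (ℤ; _◃_)
open import Data.List using (List; []; _∷_)
open import Data.List.Relation.Unary.Unique.Propositional using (Unique)
open import Data.List.Relation.Unary.All using (All)
open import Data.Product using (Σ; ∃; ∃-syntax; _×_; _,_)
open import Relation.Binary.PropositionalEquality using (_≡_; _≢_)
open import Relation.Nullary using (¬_)

-- Finite simple graphs on vertex set Fin m (Bool adjacency: no multi-
-- edges; symmetric: undirected; irreflexive: no loops).

record SimpleGraph (m : ℕ) : Set where
  field
    adj    : Fin m → Fin m → Bool
    sym    : ∀ u v → adj u v ≡ adj v u
    irrefl : ∀ u → adj u u ≡ false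

  Edge : Fin m → Fin m → Set
  Edge u v = T (adj u v)

open SimpleGraph public

-- A signed graph: a simple graph with a sign on each edge
-- (the value of σ on non-adjacent pairs is irrelevant).
record SignedGraph (m : ℕ) : Set where
  field
    graph : SimpleGraph m
    σ     : Fin m → Fin m → Sign
    σ-sym : ∀ u v → Edge graph u v → σ u v ≡ σ v u

open SignedGraph public

module _ {m : ℕ} (R : Fin m → Fin m → Set) where

  data Walk : Fin m → Fin m → Set where
    []   : ∀ {u} → Walk u u
    cons : ∀ {u v w} → R u v → Walk v w → Walk u w

module _ {m : ℕ} {R : Fin m → Fin m → Set} where

  length : ∀ {u v} → Walk R u v → ℕ
  length []         = zero
  length (cons e p) = suc (length p)

  vertices : ∀ {u v} → Walk R u v → List (Fin m)
  vertices {u} []         = u ∷ []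
  vertices {u} (cons e p) = u ∷ vertices p

  -- starting vertices of the edges (for a closed walk: each cycle vertex once)
  support : ∀ {u v} → Walk R u v → List (Fin m)
  support []               = []
  support {u} (cons e p)   = u ∷ support p

  sign : (Fin m → Fin m → Sign) → ∀ {u v} → Walk R u v → Sign
  sign τ []                 = Sign.+
  sign τ (cons {u} {v} e p) = τ u v *ˢ sign τ p

  IsPath : ∀ {u v} → Walk R u v → Set
  IsPath p = Unique (vertices p)

  IsCycle : ∀ {u} → Walk R u u → Set
  IsCycle p = (3 ≤ length p) × Unique (support p)

module _ {m : ℕ} (R : Fin m → Fin m → Set) where

  Connected : Set
  Connected = ∀ u v → Walk R u v

  IsDist : Fin m → Fin m → ℕ → Set
  IsDist u v d =
    (Σ (Walk R u v) λ p → IsPath p × length p ≡ d) ×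
    (∀ (p : Walk R u v) → IsPath p → d ≤ length p)

  IsShortest : ∀ {u v} → Walk R u v → Set
  IsShortest {u} {v} p = IsPath p × (∀ (q : Walk R u v) → IsPath q → length p ≤ length q)

data _≤ˢ_ : Sign → Sign → Set where
  -≤s  : ∀ {s} → Sign.- ≤ˢ s
  +≤+  : Sign.+ ≤ˢ Sign.+

module _ {m : ℕ} (R : Fin m → Fin m → Set) (τ : Fin m → Fin m → Sign) where

  IsMaxSign : Fin m → Fin m → Sign → Set
  IsMaxSign u v s =
    (Σ (Walk R u v) λ p → IsShortest R p × sign τ p ≡ s) ×
    (∀ (p : Walk R u v) → IsShortest R p → sign τ p ≤ˢ s)

  IsMinSign : Fin m → Fin m → Sign → Set
  IsMinSign u v s =
    (Σ (Walk R u v) λ p → IsShortest R p × sign τ p ≡ s) ×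
    (∀ (p : Walk R u v) → IsShortest R p → s ≤ˢ sign τ p)

  Compatible : Set
  Compatible = ∀ u v d smax smin →
    IsDist R u v d → IsMaxSign u v smax → IsMinSign u v smin →
    smax ◃ d ≡ smin ◃ d

  BalancedRel : Set
  BalancedRel = ∀ u (c : Walk R u u) → IsCycle c → sign τ c ≡ Sign.+

Balanced : ∀ {m} → SignedGraph m → Set
Balanced S = BalancedRel (Edge (graph S)) (σ S)

TwoConnected : ∀ {m} → SimpleGraph m → Set
TwoConnected {m} G =
  (3 ≤ m) × Connected (Edge G) ×
  (∀ x u v → u ≢ x → v ≢ x →
     Σ (Walk (Edge G) u v) λ p → All (_≢ x) (vertices p))

PowAdj : ∀ {m} → SimpleGraph m → ℕ → Fin m → Fin m → Set
PowAdj G n u v = u ≢ v × ∃[ d ] (IsDist (Edge G) u v d × d ≤ n)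

-- τ is the signature σ' of Σ^n_max, i.e. τ(uv) = σ_max(u,v) on edges of G^n
IsPowerSignature : ∀ {m} → SignedGraph m → ℕ → (Fin m → Fin m → Sign) → Set
IsPowerSignature S n τ =
  ∀ u v → PowAdj (graph S) n u v → IsMaxSign (Edge (graph S)) (σ S) u v (τ u v)

module Submission where

-- In a balanced signed graph any two walks with the same ends have the same sign: the
-- product of the first with the reverse of the second is a closed walk, and loop erasure
-- splits a closed walk into cycles and edges traversed back and forth, all of sign +.
-- An edge uv of Σⁿ carries the sign of a shortest u–v path of Σ, so substituting these
-- paths turns every walk of Σⁿ into a walk of Σ of the same sign. Hence all shortest
-- u–v paths of Σⁿ have one sign and d_max = d_min.

open import Defs hiding (sym)
open import Data.Nat using (ℕ; _≤_; z≤n; s≤s)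
open import Data.Fin using (Fin)
open import Data.Fin.Properties using (_≟_)
open import Data.Sign using (Sign) renaming (_*_ to _*ˢ_)
open import Data.Sign.Properties using (s*s≡+; *-assoc; *-identityʳ; *-comm; *-cancelʳ-≡)
open import Data.Integer using (_◃_)
open import Data.Bool using (T)
open import Data.List using (List; []; _∷_; _++_)
open import Data.List.Relation.Unary.Any using (here; there)
open import Data.List.Relation.Unary.All as All using (All; []; _∷_)
open import Data.List.Relation.Unary.All.Properties using (¬Any⇒All¬; ++⁻ˡ; ++⁻ʳ)
open import Data.List.Relation.Unary.AllPairs using ([]; _∷_)
open import Data.List.Relation.Unary.Unique.Propositional using (Unique)
open import Data.List.Relation.Binary.Disjoint.Propositional using (Disjoint)
open import Data.List.Membership.Propositional using (_∈_)
open import Data.Product using (Σ-syntax; ∃₂; _×_; _,_)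
open import Data.Empty using (⊥-elim)
open import Relation.Nullary using (yes; no)
open import Relation.Binary.PropositionalEquality

Unique-++⁻ : ∀ {a} {A : Set a} (xs : List A) {ys} →
             Unique (xs ++ ys) → Unique xs × Unique ys × Disjoint xs ys
Unique-++⁻ []       u = [] , u , λ { (() , _) }
Unique-++⁻ (x ∷ xs) (x∉xs++ys ∷ u) with uxs , uys , disjoint ← Unique-++⁻ xs u =
  ++⁻ˡ xs x∉xs++ys ∷ uxs , uys , λ where
    (here refl  , x∈ys) → All.lookup (++⁻ʳ xs x∉xs++ys) x∈ys refl
    (there v∈xs , v∈ys) → disjoint (v∈xs , v∈ys)

module _ {m : ℕ} {R : Fin m → Fin m → Set} where

  infixr 5 _++ʷ_

  _++ʷ_ : ∀ {u v w} → Walk R u v → Walk R v w → Walk R u w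
  []       ++ʷ q = q
  cons e p ++ʷ q = cons e (p ++ʷ q)

  sign-++ʷ : ∀ τ {u v w} (p : Walk R u v) (q : Walk R v w) →
             sign τ (p ++ʷ q) ≡ sign τ p *ˢ sign τ q
  sign-++ʷ τ []                   q = refl
  sign-++ʷ τ (cons {u} {v} e p) q = begin
    τ u v *ˢ sign τ (p ++ʷ q)          ≡⟨ cong (τ u v *ˢ_) (sign-++ʷ τ p q) ⟩
    τ u v *ˢ (sign τ p *ˢ sign τ q)    ≡⟨ *-assoc (τ u v) _ _ ⟨
    (τ u v *ˢ sign τ p) *ˢ sign τ q    ∎
    where open ≡-Reasoning

  vertices-++ʷ : ∀ {u v w} (p : Walk R u v) (q : Walk R v w) →
                 vertices (p ++ʷ q) ≡ support p ++ vertices q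
  vertices-++ʷ []         q = refl
  vertices-++ʷ (cons e p) q = cong (_ ∷_) (vertices-++ʷ p q)

  head∈vertices : ∀ {u v} (p : Walk R u v) → u ∈ vertices p
  head∈vertices []         = here refl
  head∈vertices (cons e p) = here refl

  last∈vertices : ∀ {u v} (p : Walk R u v) → v ∈ vertices p
  last∈vertices []         = here refl
  last∈vertices (cons e p) = there (last∈vertices p)

  splitAt : ∀ {u v w} (p : Walk R u w) → v ∈ vertices p →
            ∃₂ λ (q₁ : Walk R u v) (q₂ : Walk R v w) → q₁ ++ʷ q₂ ≡ p
  splitAt []         (here refl) = [] , [] , refl
  splitAt (cons e p) (here refl) = [] , cons e p , refl
  splitAt (cons e p) (there v∈p) with q₁ , q₂ , refl ← splitAt p v∈p =
    cons e q₁ , q₂ , refl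

module _ {m : ℕ} {R R′ : Fin m → Fin m → Set} (τ τ′ : Fin m → Fin m → Sign)
         (edgeWalk : ∀ {u v} → R′ u v → Σ[ p ∈ Walk R u v ] sign τ p ≡ τ′ u v) where

  expand : ∀ {u v} (p : Walk R′ u v) → Σ[ q ∈ Walk R u v ] sign τ q ≡ sign τ′ p
  expand []                 = [] , refl
  expand (cons {u} {v} e p) with q₁ , s₁ ← edgeWalk e | q₂ , s₂ ← expand p =
    q₁ ++ʷ q₂ , trans (sign-++ʷ τ q₁ q₂) (cong₂ _*ˢ_ s₁ s₂)

module _ {m : ℕ} (S : SignedGraph m) where

  private
    G = graph S
    R = Edge G

  edge-sym : ∀ {u v} → R u v → R v u
  edge-sym {u} {v} = subst T (SimpleGraph.sym G u v)

  reverse : ∀ {u v} → Walk R u v → Walk R v u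
  reverse []         = []
  reverse (cons e p) = reverse p ++ʷ cons (edge-sym e) []

  sign-reverse : ∀ {u v} (p : Walk R u v) → sign (σ S) (reverse p) ≡ sign (σ S) p
  sign-reverse []                 = refl
  sign-reverse (cons {u} {w} e p) = begin
    sign (σ S) (reverse p ++ʷ cons (edge-sym e) [])  ≡⟨ sign-++ʷ (σ S) (reverse p) _ ⟩
    sign (σ S) (reverse p) *ˢ (σ S w u *ˢ Sign.+)    ≡⟨ cong₂ _*ˢ_ (sign-reverse p) (*-identityʳ _) ⟩
    sign (σ S) p *ˢ σ S w u                          ≡⟨ cong (sign (σ S) p *ˢ_) (σ-sym S u w e) ⟨
    sign (σ S) p *ˢ σ S u w                          ≡⟨ *-comm (sign (σ S) p) _ ⟩
    σ S u w *ˢ sign (σ S) p                          ∎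
    where open ≡-Reasoning

  module _ (balanced : Balanced S) where

    open import Data.List.Membership.DecPropositional (_≟_ {m}) using (_∈?_)

    private
      sgn : ∀ {u v} → Walk R u v → Sign
      sgn = sign (σ S)

    simpleClosedWalk-positive : ∀ {u} (c : Walk R u u) → Unique (support c) → sgn c ≡ Sign.+
    simpleClosedWalk-positive []                           _ = refl
    simpleClosedWalk-positive (cons {u} e [])              _ = ⊥-elim (subst T (irrefl G u) e)
    simpleClosedWalk-positive (cons {u} {w} e (cons _ [])) _ = begin
      σ S u w *ˢ (σ S w u *ˢ Sign.+)  ≡⟨ cong (σ S u w *ˢ_) (*-identityʳ _) ⟩
      σ S u w *ˢ σ S w u              ≡⟨ cong (_*ˢ σ S w u) (σ-sym S u w e) ⟩
      σ S w u *ˢ σ S w u              ≡⟨ s*s≡+ (σ S w u) ⟩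
      Sign.+                          ∎
      where open ≡-Reasoning
    simpleClosedWalk-positive c@(cons _ (cons _ (cons _ _))) unique =
      balanced _ c (s≤s (s≤s (s≤s z≤n)) , unique)

    -- The prefix of q up to its visit of u closes, with e, a simple closed walk.
    shortcut : ∀ {u w v} (e : R u w) (q : Walk R w v) → IsPath q → u ∈ vertices q →
               Σ[ q′ ∈ Walk R u v ] IsPath q′ × sgn q′ ≡ σ S u w *ˢ sgn q
    shortcut {u} {w} e q q-path u∈q with q₁ , q₂ , refl ← splitAt q u∈q
      with uq₁ , uq₂ , disjoint ← Unique-++⁻ (support q₁) (subst Unique (vertices-++ʷ q₁ q₂) q-path) =
      q₂ , uq₂ , (begin
        sgn q₂                            ≡⟨ cong (_*ˢ sgn q₂) closed-positive ⟨
        (σ S u w *ˢ sgn q₁) *ˢ sgn q₂     ≡⟨ *-assoc (σ S u w) _ _ ⟩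
        σ S u w *ˢ (sgn q₁ *ˢ sgn q₂)     ≡⟨ cong (σ S u w *ˢ_) (sign-++ʷ (σ S) q₁ q₂) ⟨
        σ S u w *ˢ sgn (q₁ ++ʷ q₂)        ∎)
      where
      open ≡-Reasoning
      closed-positive : sgn (cons e q₁) ≡ Sign.+
      closed-positive = simpleClosedWalk-positive (cons e q₁)
        (¬Any⇒All¬ _ (λ u∈q₁ → disjoint (u∈q₁ , head∈vertices q₂)) ∷ uq₁)

    loopErase : ∀ {u v} (p : Walk R u v) → Σ[ q ∈ Walk R u v ] IsPath q × sgn q ≡ sgn p
    loopErase []                 = [] , [] ∷ [] , refl
    loopErase (cons {u} {w} e p) with q , q-path , sq≡sp ← loopErase p | u ∈? vertices q
    ... | no  u∉q = cons e q , ¬Any⇒All¬ _ u∉q ∷ q-path , cong (σ S u w *ˢ_) sq≡sp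
    ... | yes u∈q with q′ , q′-path , sq′ ← shortcut e q q-path u∈q =
      q′ , q′-path , trans sq′ (cong (σ S u w *ˢ_) sq≡sp)

    closedWalk-positive : ∀ {u} (c : Walk R u u) → sgn c ≡ Sign.+
    closedWalk-positive c with loopErase c
    ... | []       , _       , sc≡+ = sym sc≡+
    ... | cons e q , u∉q ∷ _ , _    = ⊥-elim (All.lookup u∉q (last∈vertices q) refl)

    sign-walk-unique : ∀ {u v} (p q : Walk R u v) → sgn p ≡ sgn q
    sign-walk-unique p q = *-cancelʳ-≡ (sgn q) (sgn p) (sgn q) (begin
      sgn p *ˢ sgn q               ≡⟨ cong (sgn p *ˢ_) (sign-reverse q) ⟨
      sgn p *ˢ sgn (reverse q)     ≡⟨ sign-++ʷ (σ S) p (reverse q) ⟨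
      sgn (p ++ʷ reverse q)        ≡⟨ closedWalk-positive (p ++ʷ reverse q) ⟩
      Sign.+                       ≡⟨ s*s≡+ (sgn q) ⟨
      sgn q *ˢ sgn q               ∎)
      where open ≡-Reasoning

powerEdgeWalk : ∀ {m} (S : SignedGraph m) (n : ℕ) (τ : Fin m → Fin m → Sign) →
                IsPowerSignature S n τ → ∀ {u v} → PowAdj (graph S) n u v →
                Σ[ p ∈ Walk (Edge (graph S)) u v ] sign (σ S) p ≡ τ u v
powerEdgeWalk S n τ τ-max {u} {v} adj with (p , _ , sp) , _ ← τ-max u v adj = p , sp

lemma2p12 : ∀ {m : ℕ} (S : SignedGraph m) (n : ℕ) → 1 ≤ n →
    TwoConnected (graph S) → Balanced S →
    (τ : Fin m → Fin m → Sign) → IsPowerSignature S n τ →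
    Compatible (PowAdj (graph S) n) τ
lemma2p12 S n _ _ balanced τ τ-max u v d smax smin _ ((p , _ , sp) , _) ((q , _ , sq) , _)
  with p′ , sp′ ← expand (σ S) τ (powerEdgeWalk S n τ τ-max) p
     | q′ , sq′ ← expand (σ S) τ (powerEdgeWalk S n τ τ-max) q =
  cong (_◃ d) (begin
    smax          ≡⟨ trans sp′ sp ⟨
    sign (σ S) p′ ≡⟨ sign-walk-unique S balanced p′ q′ ⟩
    sign (σ S) q′ ≡⟨ trans sq′ sq ⟩
    smin          ∎)
  where open ≡-Reasoning
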